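{- Let $n \geq 13$ be odd and let $G$ be a graph on $n$ vertices with $\delta(G) \geq \frac{n+1}{2}$. Let $A \subseteq V(G)$ satisfy $|A| = \frac{n+1}{2}$. If $\langle A \rangle_3 = A$, then $m(G, 3) = 3$.
   Context: Graphs are finite and simple; $\delta(G)$ is the minimum degree and $N(v)$ the neighbourhood of $v$. For an integer $r \geq 2$, the $r$-neighbour bootstrap process on $G$ started from $A \subseteq V(G)$ is defined by $A_0 = A$ and $A_t = A_{t-1} \cup \{v \in V(G) : |N(v) \cap A_{t-1}| \geq r\}$ for $t \geq 1$. The closure is $\langle A \rangle_r = \bigcup_{t \geq 0} A_t$. The set $A$ percolates if $\langle A \rangle_r = V(G)$. Define $m(G,r) = \min\{|A| : A \subseteq V(G),\ \langle A \rangle_r = V(G)\}$. -}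

module Defs where

open import Data.Nat using (ℕ; zero; suc; _≤_; _≤?_)
open import Data.Bool using (Bool; true; false; if_then_else_)
open import Data.Fin using (Fin)
open import Data.Fin.Subset using (Subset; inside; outside; _∈_; _∩_; _∪_; ∣_∣)
open import Data.Vec using (tabulate)
open import Data.Product using (Σ; ∃; _×_)
open import Relation.Nullary.Decidable using (does)
open import Relation.Binary.PropositionalEquality using (_≡_)

record Graph (n : ℕ) : Set where
  field
    adj     : Fin n → Fin n → Bool
    sym     : ∀ u v → adj u v ≡ adj v u
    irrefl  : ∀ v → adj v v ≡ false

open Graph public

N : ∀ {n} → Graph n → Fin n → Subset n
N G v = tabulate (λ w → if adj G v w then inside else outside)

degree : ∀ {n} → Graph n → Fin n → ℕ
degree G v = ∣ N G v ∣

MinDegree≥ : ∀ {n} → Graph n → ℕ → Set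
MinDegree≥ G d = ∀ v → d ≤ degree G v

step : ∀ {n} → Graph n → ℕ → Subset n → Subset n
step G r A = A ∪ tabulate (λ v → if does (r ≤? ∣ N G v ∩ A ∣) then inside else outside)

iter : ∀ {n} → Graph n → ℕ → Subset n → ℕ → Subset n
iter G r A zero    = A
iter G r A (suc t) = step G r (iter G r A t)

InClosure : ∀ {n} → Graph n → ℕ → Subset n → Fin n → Set
InClosure G r A v = ∃ λ t → v ∈ iter G r A t

ClosureEq : ∀ {n} → Graph n → ℕ → Subset n → Set
ClosureEq G r A = ∀ v → (InClosure G r A v → v ∈ A) × (v ∈ A → InClosure G r A v)

Percolates : ∀ {n} → Graph n → ℕ → Subset n → Set
Percolates G r A = ∀ v → InClosure G r A v

MinPercolating≡ : ∀ {n} → Graph n → ℕ → ℕ → Set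
MinPercolating≡ {n} G r m =
  (Σ (Subset n) λ A → ∣ A ∣ ≡ m × Percolates G r A)
  × (∀ (A : Subset n) → Percolates G r A → m ≤ ∣ A ∣)

-- Closedness of A means that every vertex outside A has at most two neighbours in A.
-- As δ ≥ k+1 and |V ∖ A| = k, the vertices outside A form a clique and each of them
-- has at least two neighbours in A. Pick b₀ ∉ A with neighbours p, q ∈ A and infect
-- {p, q, x} for some other x ∉ A; then b₀ is infected. As soon as p, q and three
-- outside vertices are infected, the whole clique follows, and the at most k − 1
-- remaining vertices each see three infected neighbours by the degree bound. The third
-- outside vertex is an outside neighbour of p, of q, or of an A-neighbour r of x; if
-- none exists, p, q and r are adjacent to all of A, which is then infected directly.
-- Conversely, a set with fewer than 3 vertices never grows.
module Submission where

open import Defs hiding (sym)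
open import Data.Nat using (ℕ; zero; suc; _+_; _*_; _∸_; _≤_; _<_; _≤?_; z≤n; s≤s)
open import Data.Nat.Properties hiding (_≟_)
open import Data.Bool using (Bool; true; T; if_then_else_)
open import Data.Fin using (Fin; _≟_)
open import Data.Fin.Subset
open import Data.Fin.Subset.Properties
open import Data.Vec using ([]; _∷_; here; there; tabulate)
open import Data.Vec.Properties using (lookup∘tabulate; lookup⇒[]=; []=⇒lookup)
open import Data.Bool.Properties using (T-≡)
open import Data.Product using (Σ; ∃; _×_; _,_; proj₁; proj₂)
open import Data.Sum using (_⊎_; inj₁; inj₂)
open import Data.Unit using (tt)
open import Function using (_∘_; id)
open import Function.Bundles using (Equivalence)
open import Relation.Nullary using (¬_; yes; no; contradiction; does)
open import Relation.Binary.PropositionalEquality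

private variable
  n : ℕ

≤-+-cancel : ∀ {a b c d} → d ≤ a + b → c + b ≤ d → c ≤ a
≤-+-cancel {a} {b} {c} d≤a+b c+b≤d = +-cancelʳ-≤ b c a (≤-trans c+b≤d d≤a+b)

∣p∪q∣≤∣p∣+∣q∣ : ∀ (p q : Subset n) → ∣ p ∪ q ∣ ≤ ∣ p ∣ + ∣ q ∣
∣p∪q∣≤∣p∣+∣q∣ []            []            = z≤n
∣p∪q∣≤∣p∣+∣q∣ (inside ∷ p)  (s ∷ q)       =
  s≤s (≤-trans (∣p∪q∣≤∣p∣+∣q∣ p q) (+-monoʳ-≤ ∣ p ∣ (∣p∣≤∣x∷p∣ s q)))
∣p∪q∣≤∣p∣+∣q∣ (outside ∷ p) (inside ∷ q)  =
  ≤-trans (s≤s (∣p∪q∣≤∣p∣+∣q∣ p q)) (≤-reflexive (sym (+-suc ∣ p ∣ ∣ q ∣)))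
∣p∪q∣≤∣p∣+∣q∣ (outside ∷ p) (outside ∷ q) = ∣p∪q∣≤∣p∣+∣q∣ p q

p⊆q∪r⇒∣p∣≤∣q∣+∣r∣ : ∀ {p q r : Subset n} → (∀ {x} → x ∈ p → x ∈ q ⊎ x ∈ r) → ∣ p ∣ ≤ ∣ q ∣ + ∣ r ∣
p⊆q∪r⇒∣p∣≤∣q∣+∣r∣ {q = q} {r} p⊆q∪r =
  ≤-trans (p⊆q⇒∣p∣≤∣q∣ (x∈p∪q⁺ ∘ p⊆q∪r)) (∣p∪q∣≤∣p∣+∣q∣ q r)

∈∉⇒≢ : ∀ {p : Subset n} {x y} → x ∈ p → y ∉ p → x ≢ y
∈∉⇒≢ x∈p y∉p refl = y∉p x∈p

x∈p─q⇒x∉q : ∀ {p q : Subset n} {x} → x ∈ p ─ q → x ∉ q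
x∈p─q⇒x∉q {p = _ ∷ p} {outside ∷ q} here       ()
x∈p─q⇒x∉q {p = _ ∷ p} {outside ∷ q} (there x∈) (there x∈q) = x∈p─q⇒x∉q {p = p} x∈ x∈q
x∈p─q⇒x∉q {p = _ ∷ p} {inside ∷ q}  (there x∈) (there x∈q) = x∈p─q⇒x∉q {p = p} x∈ x∈q

x∈p-y⁻ : ∀ {p : Subset n} {x y} → x ∈ p - y → x ∈ p × x ≢ y
x∈p-y⁻ {p = p} {y = y} x∈ = p─q⊆p p ⁅ y ⁆ x∈ , λ { refl → x∈p─q⇒x∉q {p = p} x∈ (x∈⁅x⁆ y) }

∣p∣≤1+∣p-x∣ : ∀ (p : Subset n) x → ∣ p ∣ ≤ suc ∣ p - x ∣
∣p∣≤1+∣p-x∣ p x = ≤-trans (p⊆q∪r⇒∣p∣≤∣q∣+∣r∣ split) (≤-reflexive (cong (_+ ∣ p - x ∣) (∣⁅x⁆∣≡1 x)))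
  where
  split : ∀ {w} → w ∈ p → w ∈ ⁅ x ⁆ ⊎ w ∈ p - x
  split {w} w∈p with w ≟ x
  ... | yes refl = inj₁ (x∈⁅x⁆ x)
  ... | no w≢x   = inj₂ (x∈p∧x≢y⇒x∈p-y w∈p w≢x)

2+∣p-x-y∣≤∣p∣ : ∀ {p : Subset n} {x y} → x ∈ p → y ∈ p → x ≢ y → 2 + ∣ p - x - y ∣ ≤ ∣ p ∣
2+∣p-x-y∣≤∣p∣ x∈p y∈p x≢y =
  ≤-trans (s≤s (x∈p⇒∣p-x∣<∣p∣ (x∈p∧x≢y⇒x∈p-y y∈p (≢-sym x≢y)))) (x∈p⇒∣p-x∣<∣p∣ x∈p)

distinct⇒3≤∣p∣ : ∀ {p : Subset n} {x y z} → x ∈ p → y ∈ p → z ∈ p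
               → x ≢ y → x ≢ z → y ≢ z → 3 ≤ ∣ p ∣
distinct⇒3≤∣p∣ x∈p y∈p z∈p x≢y x≢z y≢z =
  ≤-trans (+-monoʳ-≤ 2 (≤-trans (s≤s z≤n) (x∈p⇒∣p-x∣<∣p∣ z∈p-x-y))) (2+∣p-x-y∣≤∣p∣ x∈p y∈p x≢y)
  where
  z∈p-x-y = x∈p∧x≢y⇒x∈p-y (x∈p∧x≢y⇒x∈p-y z∈p (≢-sym x≢z)) (≢-sym y≢z)

∣p∣>0⇒nonempty : ∀ {p : Subset n} → 0 < ∣ p ∣ → Nonempty p
∣p∣>0⇒nonempty {n} {p} 0<∣p∣ with nonempty? p
... | yes ne  = ne
... | no ¬ne = contradiction
  (≤-trans 0<∣p∣ (≤-reflexive (trans (cong ∣_∣ (Empty-unique ¬ne)) (∣⊥∣≡0 n)))) n≮0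

∣p∣>1⇒∃≢ : ∀ (p : Subset n) y → 1 < ∣ p ∣ → ∃ λ x → x ∈ p × x ≢ y
∣p∣>1⇒∃≢ p y 1<∣p∣ with ∣p∣>0⇒nonempty (≤-pred (≤-trans 1<∣p∣ (∣p∣≤1+∣p-x∣ p y)))
... | x , x∈p-y = x , x∈p-y⁻ {p = p} x∈p-y

∣p∣>2⇒∃≢₂ : ∀ (p : Subset n) y z → 2 < ∣ p ∣ → ∃ λ x → x ∈ p × x ≢ y × x ≢ z
∣p∣>2⇒∃≢₂ p y z 2<∣p∣ with ∣p∣>1⇒∃≢ (p - y) z (≤-pred (≤-trans 2<∣p∣ (∣p∣≤1+∣p-x∣ p y)))
... | x , x∈p-y , x≢z = x , proj₁ (x∈p-y⁻ {p = p} x∈p-y) , proj₂ (x∈p-y⁻ {p = p} x∈p-y) , x≢z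

triple : Fin n → Fin n → Fin n → Subset n
triple x y z = ⁅ x ⁆ ∪ ⁅ y ⁆ ∪ ⁅ z ⁆

x∈triple : ∀ (x y z : Fin n) → x ∈ triple x y z
x∈triple x y z = x∈p∪q⁺ (inj₁ (x∈⁅x⁆ x))

y∈triple : ∀ (x y z : Fin n) → y ∈ triple x y z
y∈triple x y z = x∈p∪q⁺ (inj₂ (x∈p∪q⁺ (inj₁ (x∈⁅x⁆ y))))

z∈triple : ∀ (x y z : Fin n) → z ∈ triple x y z
z∈triple x y z = x∈p∪q⁺ (inj₂ (x∈p∪q⁺ (inj₂ (x∈⁅x⁆ z))))

∣triple∣≡3 : ∀ {x y z : Fin n} → x ≢ y → x ≢ z → y ≢ z → ∣ triple x y z ∣ ≡ 3
∣triple∣≡3 {x = x} {y} {z} x≢y x≢z y≢z = ≤-antisym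
  (≤-trans (∣p∪q∣≤∣p∣+∣q∣ ⁅ x ⁆ (⁅ y ⁆ ∪ ⁅ z ⁆))
    (+-mono-≤ (≤-reflexive (∣⁅x⁆∣≡1 x))
      (≤-trans (∣p∪q∣≤∣p∣+∣q∣ ⁅ y ⁆ ⁅ z ⁆) (≤-reflexive (cong₂ _+_ (∣⁅x⁆∣≡1 y) (∣⁅x⁆∣≡1 z))))))
  (distinct⇒3≤∣p∣ (x∈triple x y z) (y∈triple x y z) (z∈triple x y z) x≢y x≢z y≢z)

∈-tabulate⁺ : ∀ (f : Fin n → Bool) {x} → T (f x) → x ∈ tabulate (λ v → if f v then inside else outside)
∈-tabulate⁺ f {x} t = lookup⇒[]= x _
  (trans (lookup∘tabulate _ x) (cong (λ b → if b then inside else outside) (Equivalence.to T-≡ t)))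

∈-tabulate⁻ : ∀ (f : Fin n → Bool) {x} → x ∈ tabulate (λ v → if f v then inside else outside) → T (f x)
∈-tabulate⁻ f {x} x∈ = inside⇒T (f x) (trans (sym (lookup∘tabulate _ x)) ([]=⇒lookup x∈))
  where
  inside⇒T : ∀ b → (if b then inside else outside) ≡ inside → T b
  inside⇒T true  _ = tt

module _ (G : Graph n) where

  ∈N⁺ : ∀ {v w} → T (adj G v w) → w ∈ N G v
  ∈N⁺ {v} = ∈-tabulate⁺ (adj G v)

  ∈N⁻ : ∀ {v w} → w ∈ N G v → T (adj G v w)
  ∈N⁻ {v} = ∈-tabulate⁻ (adj G v)

  ∈N-sym : ∀ {v w} → w ∈ N G v → v ∈ N G w
  ∈N-sym {v} {w} w∈N = ∈N⁺ (subst T (Graph.sym G v w) (∈N⁻ w∈N))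

  ∈N⇒≢ : ∀ {v w} → w ∈ N G v → w ≢ v
  ∈N⇒≢ {v} w∈N refl = subst T (Graph.irrefl G v) (∈N⁻ w∈N)

  ⊆-step : ∀ {r I} → I ⊆ step G r I
  ⊆-step = x∈p∪q⁺ ∘ inj₁

  step⁺ : ∀ {r I v} → r ≤ ∣ N G v ∩ I ∣ → v ∈ step G r I
  step⁺ {r} {I} {v} r≤ = x∈p∪q⁺ (inj₂ (∈-tabulate⁺ (λ u → does (r ≤? ∣ N G u ∩ I ∣)) {v}
                                          (≤⇒≤ᵇ r≤)))

  step⁻ : ∀ {r I v} → v ∈ step G r I → v ∈ I ⊎ r ≤ ∣ N G v ∩ I ∣
  step⁻ {r} {I} {v} v∈ with x∈p∪q⁻ I _ v∈
  ... | inj₁ v∈I  = inj₁ v∈I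
  ... | inj₂ v∈new = inj₂ (≤ᵇ⇒≤ r _ (∈-tabulate⁻ (λ u → does (r ≤? ∣ N G u ∩ I ∣)) v∈new))

  step-three : ∀ {I v x y z} → x ∈ N G v → y ∈ N G v → z ∈ N G v → x ∈ I → y ∈ I → z ∈ I
             → x ≢ y → x ≢ z → y ≢ z → v ∈ step G 3 I
  step-three x∈N y∈N z∈N x∈I y∈I z∈I x≢y x≢z y≢z =
    step⁺ (distinct⇒3≤∣p∣ (x∈p∩q⁺ (x∈N , x∈I)) (x∈p∩q⁺ (y∈N , y∈I)) (x∈p∩q⁺ (z∈N , z∈I)) x≢y x≢z y≢z)

  iter⊆ : ∀ {r P} → ∣ P ∣ < r → ∀ t → iter G r P t ⊆ P
  iter⊆ ∣P∣<r zero = id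
  iter⊆ {r} {P} ∣P∣<r (suc t) {v} v∈ with step⁻ v∈
  ... | inj₁ v∈I = iter⊆ ∣P∣<r t v∈I
  ... | inj₂ r≤  = contradiction
    (≤-trans r≤ (≤-trans (∣p∩q∣≤∣q∣ (N G v) _) (p⊆q⇒∣p∣≤∣q∣ (iter⊆ ∣P∣<r t)))) (<⇒≱ ∣P∣<r)

  percolating⇒r≤∣p∣ : ∀ {r P} → r ≤ n → Percolates G r P → r ≤ ∣ P ∣
  percolating⇒r≤∣p∣ {r} {P} r≤n perc with r ≤? ∣ P ∣
  ... | yes r≤∣P∣ = r≤∣P∣
  ... | no r≰∣P∣  = contradiction
    (≤-trans r≤n (≤-trans (≤-reflexive (sym (∣⊤∣≡n n))) (p⊆q⇒∣p∣≤∣q∣ ⊤⊆P))) (<⇒≱ (≰⇒> r≰∣P∣))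
    where
    ⊤⊆P : ⊤ ⊆ P
    ⊤⊆P {v} _ = iter⊆ (≰⇒> r≰∣P∣) (proj₁ (perc v)) (proj₂ (perc v))

  degree≤∣N∩p∣+∣q∣ : ∀ {v} p q → (∀ {w} → w ∈ N G v → w ∉ p → w ∈ q) → degree G v ≤ ∣ N G v ∩ p ∣ + ∣ q ∣
  degree≤∣N∩p∣+∣q∣ {v} p q rest = p⊆q∪r⇒∣p∣≤∣q∣+∣r∣ split
    where
    split : ∀ {w} → w ∈ N G v → w ∈ N G v ∩ p ⊎ w ∈ q
    split {w} w∈N with w ∈? p
    ... | yes w∈p = inj₁ (x∈p∩q⁺ (w∈N , w∈p))
    ... | no w∉p  = inj₂ (rest w∈N w∉p)

  -- A healthy vertex has at most |∁ I| − 1 healthy neighbours.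
  r+∣∁I∣≤1+δ⇒step-full : ∀ {d r} I → MinDegree≥ G d → r + ∣ ∁ I ∣ ≤ suc d → ∀ v → v ∈ step G r I
  r+∣∁I∣≤1+δ⇒step-full {d} {r} I δ≥ r+∣∁I∣≤1+d v with v ∈? I
  ... | yes v∈I = ⊆-step {r} v∈I
  ... | no v∉I  = step⁺ (≤-+-cancel (≤-trans (δ≥ v) (degree≤∣N∩p∣+∣q∣ I (∁ I - v) healthy)) bound)
    where
    healthy : ∀ {w} → w ∈ N G v → w ∉ I → w ∈ ∁ I - v
    healthy w∈N w∉I = x∈p∧x≢y⇒x∈p-y (x∉p⇒x∈∁p w∉I) (∈N⇒≢ w∈N)
    bound : r + ∣ ∁ I - v ∣ ≤ d
    bound = ≤-pred (≤-trans (≤-reflexive (sym (+-suc r _)))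
                     (≤-trans (+-monoʳ-≤ r (x∈p⇒∣p-x∣<∣p∣ (x∉p⇒x∈∁p v∉I))) r+∣∁I∣≤1+d))

module HalfClosed {k : ℕ} {G : Graph (suc (2 * k))} (δ≥ : MinDegree≥ G (suc k))
                  {A : Subset (suc (2 * k))} (∣A∣≡ : ∣ A ∣ ≡ suc k) (closed : ClosureEq G 3 A) where

  V : Set
  V = Fin (suc (2 * k))

  ∣∁A∣≡k : ∣ ∁ A ∣ ≡ k
  ∣∁A∣≡k = begin
    ∣ ∁ A ∣               ≡⟨ ∣∁p∣≡n∸∣p∣ A ⟩
    suc (2 * k) ∸ ∣ A ∣   ≡⟨ cong (suc (2 * k) ∸_) ∣A∣≡ ⟩
    k + (k + 0) ∸ k       ≡⟨ m+n∸m≡n k (k + 0) ⟩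
    k + 0                 ≡⟨ +-identityʳ k ⟩
    k                     ∎
    where open ≡-Reasoning

  3≤∣N∩A∣⇒∈A : ∀ {v} → 3 ≤ ∣ N G v ∩ A ∣ → v ∈ A
  3≤∣N∩A∣⇒∈A {v} 3≤ = proj₁ (closed v) (1 , step⁺ G 3≤)

  ∉A-adjacent : ∀ {b b′} → b ∉ A → b′ ∉ A → b ≢ b′ → b′ ∈ N G b
  ∉A-adjacent {b} {b′} b∉A b′∉A b≢b′ with b′ ∈? N G b
  ... | yes b′∈N = b′∈N
  ... | no b′∉N  = contradiction
    (3≤∣N∩A∣⇒∈A (≤-+-cancel (≤-trans (δ≥ b) (degree≤∣N∩p∣+∣q∣ G A (∁ A - b - b′) rest)) bound)) b∉A
    where
    rest : ∀ {w} → w ∈ N G b → w ∉ A → w ∈ ∁ A - b - b′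
    rest w∈N w∉A = x∈p∧x≢y⇒x∈p-y (x∈p∧x≢y⇒x∈p-y (x∉p⇒x∈∁p w∉A) (∈N⇒≢ G w∈N)) λ { refl → b′∉N w∈N }
    bound : 3 + ∣ ∁ A - b - b′ ∣ ≤ suc k
    bound = s≤s (≤-trans (2+∣p-x-y∣≤∣p∣ (x∉p⇒x∈∁p b∉A) (x∉p⇒x∈∁p b′∉A) b≢b′) (≤-reflexive ∣∁A∣≡k))

  ∉A⇒2≤∣N∩A∣ : ∀ {b} → b ∉ A → 2 ≤ ∣ N G b ∩ A ∣
  ∉A⇒2≤∣N∩A∣ {b} b∉A = ≤-+-cancel (≤-trans (δ≥ b) (degree≤∣N∩p∣+∣q∣ G A (∁ A - b) rest)) bound
    where
    rest : ∀ {w} → w ∈ N G b → w ∉ A → w ∈ ∁ A - b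
    rest w∈N w∉A = x∈p∧x≢y⇒x∈p-y (x∉p⇒x∈∁p w∉A) (∈N⇒≢ G w∈N)
    bound : 2 + ∣ ∁ A - b ∣ ≤ suc k
    bound = s≤s (≤-trans (x∈p⇒∣p-x∣<∣p∣ (x∉p⇒x∈∁p b∉A)) (≤-reflexive ∣∁A∣≡k))

  HasOutsideNeighbour : V → V → Set
  HasOutsideNeighbour a b = ∃ λ y → y ∉ A × y ≢ b × y ∈ N G a

  AdjacentToRestOfA : V → Set
  AdjacentToRestOfA a = ∀ {a′} → a′ ∈ A → a′ ≢ a → a′ ∈ N G a

  -- Without outside neighbours besides b, the k+1 neighbours of a lie in (A − a) ∪ {b}.
  outside-neighbour-or-adjacent-to-A : ∀ {a} b → a ∈ A →
    HasOutsideNeighbour a b ⊎ (¬ HasOutsideNeighbour a b × AdjacentToRestOfA a)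
  outside-neighbour-or-adjacent-to-A {a} b a∈A with nonempty? (N G a ∩ (∁ A - b))
  ... | yes (y , y∈) =
    let y∈N , y∈∁A-b = x∈p∩q⁻ (N G a) _ y∈
        y∈∁A , y≢b   = x∈p-y⁻ {p = ∁ A} y∈∁A-b
    in inj₁ (y , x∈∁p⇒x∉p y∈∁A , y≢b , y∈N)
  ... | no none = inj₂ (no-outside , adjacent)
    where
    no-outside : ¬ HasOutsideNeighbour a b
    no-outside (y , y∉A , y≢b , y∈N) = none (y , x∈p∩q⁺ (y∈N , x∈p∧x≢y⇒x∈p-y (x∉p⇒x∈∁p y∉A) y≢b))
    adjacent : AdjacentToRestOfA a
    adjacent {a′} a′∈A a′≢a with a′ ∈? N G a
    ... | yes a′∈N = a′∈N
    ... | no a′∉N  = contradiction (∣p∣>0⇒nonempty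
      (≤-+-cancel (≤-trans (δ≥ a) (degree≤∣N∩p∣+∣q∣ G (∁ A - b) (⁅ b ⁆ ∪ (A - a - a′)) rest)) bound)) none
      where
      rest : ∀ {w} → w ∈ N G a → w ∉ ∁ A - b → w ∈ ⁅ b ⁆ ∪ (A - a - a′)
      rest {w} w∈N w∉ with w ≟ b
      ... | yes refl = x∈p∪q⁺ (inj₁ (x∈⁅x⁆ b))
      ... | no w≢b   = x∈p∪q⁺ (inj₂ (x∈p∧x≢y⇒x∈p-y (x∈p∧x≢y⇒x∈p-y w∈A (∈N⇒≢ G w∈N)) λ { refl → a′∉N w∈N }))
        where
        w∈A : w ∈ A
        w∈A = x∉∁p⇒x∈p (λ w∈∁A → w∉ (x∈p∧x≢y⇒x∈p-y w∈∁A w≢b))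
      bound : 1 + ∣ ⁅ b ⁆ ∪ (A - a - a′) ∣ ≤ suc k
      bound = ≤-trans (s≤s (≤-trans (∣p∪q∣≤∣p∣+∣q∣ ⁅ b ⁆ (A - a - a′)) (≤-reflexive (cong (_+ _) (∣⁅x⁆∣≡1 b)))))
                (≤-trans (2+∣p-x-y∣≤∣p∣ a∈A a′∈A (≢-sym a′≢a)) (≤-reflexive ∣A∣≡))

  step-full-if-healthy⊆ : ∀ {I R} → (∀ {w} → w ∉ I → w ∈ R) → 2 + ∣ R ∣ ≤ suc k → ∀ v → v ∈ step G 3 I
  step-full-if-healthy⊆ {I} {R} healthy 2+∣R∣≤ = r+∣∁I∣≤1+δ⇒step-full G I δ≥
    (s≤s (≤-trans (+-monoʳ-≤ 2 (p⊆q⇒∣p∣≤∣q∣ (healthy ∘ x∈∁p⇒x∉p))) 2+∣R∣≤))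

  outside-infected : ∀ {I b₀ x y} → b₀ ∉ A → x ∉ A → y ∉ A → b₀ ≢ x → b₀ ≢ y → x ≢ y
                   → b₀ ∈ I → x ∈ I → y ∈ I → ∀ {b} → b ∉ A → b ∈ step G 3 I
  outside-infected {I} b₀∉A x∉A y∉A b₀≢x b₀≢y x≢y b₀∈I x∈I y∈I {b} b∉A with b ∈? I
  ... | yes b∈I = ⊆-step G b∈I
  ... | no b∉I  = step-three G (adjacent b₀∉A b₀∈I) (adjacent x∉A x∈I) (adjacent y∉A y∈I)
                    b₀∈I x∈I y∈I b₀≢x b₀≢y x≢y
    where
    adjacent : ∀ {c} → c ∉ A → c ∈ I → c ∈ N G b
    adjacent c∉A c∈I = ∉A-adjacent b∉A c∉A (≢-sym (∈∉⇒≢ c∈I b∉I))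

  two-inside-three-outside⇒step²-full : ∀ {I p q b₀ x y} → p ∈ A → q ∈ A → p ≢ q
    → b₀ ∉ A → x ∉ A → y ∉ A → b₀ ≢ x → b₀ ≢ y → x ≢ y
    → p ∈ I → q ∈ I → b₀ ∈ I → x ∈ I → y ∈ I → ∀ v → v ∈ step G 3 (step G 3 I)
  two-inside-three-outside⇒step²-full {I} {p} {q} p∈A q∈A p≢q b₀∉A x∉A y∉A b₀≢x b₀≢y x≢y p∈I q∈I b₀∈I x∈I y∈I =
    step-full-if-healthy⊆ healthy (≤-trans (2+∣p-x-y∣≤∣p∣ p∈A q∈A p≢q) (≤-reflexive ∣A∣≡))
    where
    healthy : ∀ {w} → w ∉ step G 3 I → w ∈ A - p - q
    healthy {w} w∉ with w ∈? A
    ... | no w∉A  = contradiction (outside-infected b₀∉A x∉A y∉A b₀≢x b₀≢y x≢y b₀∈I x∈I y∈I w∉A) w∉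
    ... | yes w∈A = x∈p∧x≢y⇒x∈p-y (x∈p∧x≢y⇒x∈p-y w∈A (≢-sym (∈∉⇒≢ (⊆-step G p∈I) w∉)))
                                  (≢-sym (∈∉⇒≢ (⊆-step G q∈I) w∉))

  PercolatingTriple : Set
  PercolatingTriple = Σ (Subset (suc (2 * k))) λ T → ∣ T ∣ ≡ 3 × Percolates G 3 T

  module _ {b₀ p q : V} (b₀∉A : b₀ ∉ A) (p∈A : p ∈ A) (q∈A : q ∈ A) (p≢q : p ≢ q)
           (p∈N : p ∈ N G b₀) (q∈N : q ∈ N G b₀) where

    b₀∈step-triple : ∀ {x} → x ∉ A → x ≢ b₀ → b₀ ∈ step G 3 (triple p q x)
    b₀∈step-triple {x} x∉A x≢b₀ = step-three G p∈N q∈N (∉A-adjacent b₀∉A x∉A (≢-sym x≢b₀))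
      (x∈triple p q x) (y∈triple p q x) (z∈triple p q x) p≢q (∈∉⇒≢ p∈A x∉A) (∈∉⇒≢ q∈A x∉A)

    -- y is infected in the second step by s, b₀ and x; four steps then suffice.
    triple-percolates : ∀ {x s y} → x ∉ A → x ≢ b₀ → s ∈ A → s ∈ step G 3 (triple p q x)
      → y ∉ A → y ∈ N G s → y ≢ b₀ → y ≢ x → PercolatingTriple
    triple-percolates {x} {s} {y} x∉A x≢b₀ s∈A s∈I₁ y∉A y∈N y≢b₀ y≢x =
      triple p q x , ∣triple∣≡3 p≢q (∈∉⇒≢ p∈A x∉A) (∈∉⇒≢ q∈A x∉A) , λ v → 4 ,
        two-inside-three-outside⇒step²-full p∈A q∈A p≢q b₀∉A x∉A y∉A (≢-sym x≢b₀) (≢-sym y≢b₀) (≢-sym y≢x)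
          (in₂ (x∈triple p q x)) (in₂ (y∈triple p q x)) (⊆-step G b₀∈I₁) (in₂ (z∈triple p q x)) y∈I₂ v
      where
      in₂ : triple p q x ⊆ step G 3 (step G 3 (triple p q x))
      in₂ = ⊆-step G ∘ ⊆-step G
      b₀∈I₁ = b₀∈step-triple x∉A x≢b₀
      y∈I₂ : y ∈ step G 3 (step G 3 (triple p q x))
      y∈I₂ = step-three G (∈N-sym G y∈N) (∉A-adjacent y∉A b₀∉A y≢b₀) (∉A-adjacent y∉A x∉A y≢x)
               s∈I₁ b₀∈I₁ (⊆-step G (z∈triple p q x)) (∈∉⇒≢ s∈A b₀∉A) (∈∉⇒≢ s∈A x∉A) (≢-sym x≢b₀)

    via-outside-neighbour : 2 < k → HasOutsideNeighbour p b₀ → PercolatingTriple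
    via-outside-neighbour 2<k (y , y∉A , y≢b₀ , y∈N)
      with ∣p∣>2⇒∃≢₂ (∁ A) b₀ y (≤-trans 2<k (≤-reflexive (sym ∣∁A∣≡k)))
    ... | x , x∈∁A , x≢b₀ , x≢y = triple-percolates (x∈∁p⇒x∉p x∈∁A) x≢b₀ p∈A
                                     (⊆-step G (x∈triple p q x)) y∉A y∈N y≢b₀ (≢-sym x≢y)

    via-neighbour-of-x : ∀ {x r} → ¬ HasOutsideNeighbour p b₀ → ¬ HasOutsideNeighbour q b₀
      → AdjacentToRestOfA p → AdjacentToRestOfA q → x ∉ A → x ≢ b₀ → r ∈ A → r ∈ N G x
      → PercolatingTriple
    via-neighbour-of-x {x} {r} ¬out-p ¬out-q adj-p adj-q x∉A x≢b₀ r∈A r∈N =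
      cases (outside-neighbour-or-adjacent-to-A x r∈A)
      where
      I₁ = step G 3 (triple p q x)
      r≢p : r ≢ p
      r≢p refl = ¬out-p (x , x∉A , x≢b₀ , ∈N-sym G r∈N)
      r≢q : r ≢ q
      r≢q refl = ¬out-q (x , x∉A , x≢b₀ , ∈N-sym G r∈N)
      r∈I₁ : r ∈ I₁
      r∈I₁ = step-three G (∈N-sym G (adj-p r∈A r≢p)) (∈N-sym G (adj-q r∈A r≢q)) (∈N-sym G r∈N)
        (x∈triple p q x) (y∈triple p q x) (z∈triple p q x) p≢q (∈∉⇒≢ p∈A x∉A) (∈∉⇒≢ q∈A x∉A)
      A⊆I₂ : ∀ {a} → AdjacentToRestOfA r → a ∈ A → a ∈ step G 3 I₁
      A⊆I₂ {a} adj-r a∈A with a ∈? I₁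
      ... | yes a∈I₁ = ⊆-step G a∈I₁
      ... | no a∉I₁  = step-three G (adjacent adj-p (⊆-step G (x∈triple p q x))) (adjacent adj-q (⊆-step G (y∈triple p q x)))
                         (adjacent adj-r r∈I₁) (⊆-step G (x∈triple p q x)) (⊆-step G (y∈triple p q x)) r∈I₁
                         p≢q (≢-sym r≢p) (≢-sym r≢q)
        where
        adjacent : ∀ {c} → AdjacentToRestOfA c → c ∈ I₁ → c ∈ N G a
        adjacent adj-c c∈I₁ = ∈N-sym G (adj-c a∈A (≢-sym (∈∉⇒≢ c∈I₁ a∉I₁)))
      cases : HasOutsideNeighbour r x ⊎ (¬ HasOutsideNeighbour r x × AdjacentToRestOfA r) → PercolatingTriple
      cases (inj₁ (y , y∉A , y≢x , y∈N)) = triple-percolates x∉A x≢b₀ r∈A r∈I₁ y∉A y∈N y≢b₀ y≢x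
        where
        y≢b₀ : y ≢ b₀
        y≢b₀ refl = b₀∉A (3≤∣N∩A∣⇒∈A (distinct⇒3≤∣p∣ (x∈p∩q⁺ (p∈N , p∈A)) (x∈p∩q⁺ (q∈N , q∈A))
                      (x∈p∩q⁺ (∈N-sym G y∈N , r∈A)) p≢q (≢-sym r≢p) (≢-sym r≢q)))
      cases (inj₂ (_ , adj-r)) =
        triple p q x , ∣triple∣≡3 p≢q (∈∉⇒≢ p∈A x∉A) (∈∉⇒≢ q∈A x∉A) , λ v → 3 ,
          step-full-if-healthy⊆ healthy (s≤s (≤-trans (x∈p⇒∣p-x∣<∣p∣ (x∉p⇒x∈∁p b₀∉A)) (≤-reflexive ∣∁A∣≡k))) v
        where
        healthy : ∀ {w} → w ∉ step G 3 I₁ → w ∈ ∁ A - b₀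
        healthy w∉ = x∈p∧x≢y⇒x∈p-y (x∉p⇒x∈∁p (w∉ ∘ A⊆I₂ adj-r))
                       (≢-sym (∈∉⇒≢ (⊆-step G (b₀∈step-triple x∉A x≢b₀)) w∉))

    via-adjacent-to-A : 1 < k → ¬ HasOutsideNeighbour p b₀ → ¬ HasOutsideNeighbour q b₀
      → AdjacentToRestOfA p → AdjacentToRestOfA q → PercolatingTriple
    via-adjacent-to-A 1<k ¬out-p ¬out-q adj-p adj-q
      with ∣p∣>1⇒∃≢ (∁ A) b₀ (≤-trans 1<k (≤-reflexive (sym ∣∁A∣≡k)))
    ... | x , x∈∁A , x≢b₀ with ∣p∣>0⇒nonempty (≤-trans (s≤s z≤n) (∉A⇒2≤∣N∩A∣ (x∈∁p⇒x∉p x∈∁A)))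
    ... | r , r∈N∩A = via-neighbour-of-x ¬out-p ¬out-q adj-p adj-q (x∈∁p⇒x∉p x∈∁A) x≢b₀
                        (proj₂ (x∈p∩q⁻ (N G x) A r∈N∩A)) (proj₁ (x∈p∩q⁻ (N G x) A r∈N∩A))

  percolating-triple : 2 < k → PercolatingTriple
  percolating-triple 2<k with ∣p∣>0⇒nonempty (≤-trans (s≤s z≤n) (≤-trans 2<k (≤-reflexive (sym ∣∁A∣≡k))))
  ... | b₀ , b₀∈∁A with ∣p∣>0⇒nonempty (≤-trans (s≤s z≤n) (∉A⇒2≤∣N∩A∣ (x∈∁p⇒x∉p b₀∈∁A)))
  ... | p , p∈N∩A with ∣p∣>1⇒∃≢ (N G b₀ ∩ A) p (∉A⇒2≤∣N∩A∣ (x∈∁p⇒x∉p b₀∈∁A))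
  ... | q , q∈N∩A , q≢p =
    cases (outside-neighbour-or-adjacent-to-A b₀ p∈A) (outside-neighbour-or-adjacent-to-A b₀ q∈A)
    where
    b₀∉A = x∈∁p⇒x∉p b₀∈∁A
    p∈A = proj₂ (x∈p∩q⁻ (N G b₀) A p∈N∩A)
    q∈A = proj₂ (x∈p∩q⁻ (N G b₀) A q∈N∩A)
    p∈N = proj₁ (x∈p∩q⁻ (N G b₀) A p∈N∩A)
    q∈N = proj₁ (x∈p∩q⁻ (N G b₀) A q∈N∩A)
    cases : HasOutsideNeighbour p b₀ ⊎ (¬ HasOutsideNeighbour p b₀ × AdjacentToRestOfA p)
          → HasOutsideNeighbour q b₀ ⊎ (¬ HasOutsideNeighbour q b₀ × AdjacentToRestOfA q)
          → PercolatingTriple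
    cases (inj₁ out-p) _ = via-outside-neighbour b₀∉A p∈A q∈A (≢-sym q≢p) p∈N q∈N 2<k out-p
    cases (inj₂ _) (inj₁ out-q) = via-outside-neighbour b₀∉A q∈A p∈A q≢p q∈N p∈N 2<k out-q
    cases (inj₂ (¬out-p , adj-p)) (inj₂ (¬out-q , adj-q)) =
      via-adjacent-to-A b₀∉A p∈A q∈A (≢-sym q≢p) p∈N q∈N (<-trans (n<1+n 1) 2<k) ¬out-p ¬out-q adj-p adj-q

open HalfClosed using (percolating-triple)

proposition4p3 : (k : ℕ) → 6 ≤ k → (G : Graph (suc (2 * k)))
    → MinDegree≥ G (suc k)
    → (A : Subset (suc (2 * k))) → ∣ A ∣ ≡ suc k
    → ClosureEq G 3 A
    → MinPercolating≡ G 3 3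
proposition4p3 k 6≤k G δ≥ A ∣A∣≡ closed =
  percolating-triple δ≥ ∣A∣≡ closed 2<k , λ P → percolating⇒r≤∣p∣ G 3≤n
  where
  2<k : 2 < k
  2<k = ≤-trans (s≤s (s≤s (s≤s z≤n))) 6≤k
  3≤n : 3 ≤ suc (2 * k)
  3≤n = s≤s (≤-trans (<⇒≤ 2<k) (m≤m+n k (k + 0)))
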